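{- Let $A=A_1\cdots A_m$ and $B=B_1\cdots B_n$ be strings and let $G_{A,B}$ be the grid graph described in the context. Consider the dynamic programming table $len(i,j)$, $0\le i\le m$, $0\le j\le n$, given by $len(i,0)=len(0,j)=0$ and, for $i,j\ge 1$, $len(i,j)=\max$ of $len(i,j-1)$ (option $\leftarrow$), $len(i-1,j)$ (option $\uparrow$), and, only when $A_i=B_j$, $len(i-1,j-1)+1$ (option $\nwarrow$); set $parent(i,j)$ to an option achieving the maximum, breaking ties by preferring $\leftarrow$ first, then $\nwarrow$, and finally $\uparrow$ (and set $parent(0,j)=\leftarrow$ for $j\ge1$, $parent(i,0)=\uparrow$ for $i\ge1$). Then the set of edges $\{(\text{node indicated by } parent(v)) \to v\}$ forms a lowest shortest path tree of $G_{A,B}$ rooted at $(0,0)$.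
   Context: $G_{A,B}$ is the directed graph with nodes $(i,j)$, $0\le i\le m$, $0\le j\le n$ (first coordinate = row, second = column; $(0,0)$ is the top-left and $(m,n)$ the bottom-right), with edges $(i,j-1)\to(i,j)$ (horizontal, direction $\leftarrow$ as a parent pointer), $(i-1,j)\to(i,j)$ (vertical, $\uparrow$), and $(i-1,j-1)\to(i,j)$ (diagonal, $\nwarrow$) whenever $A_i=B_j$; all edges have length $1$. The parent pointer $\leftarrow$ at $(i,j)$ refers to node $(i,j-1)$, $\uparrow$ to $(i-1,j)$, $\nwarrow$ to $(i-1,j-1)$. A shortest path tree rooted at $(0,0)$ is a spanning tree in which the tree path from $(0,0)$ to every node is a shortest path. For two distinct paths $p,p'$ from $(0,0)$ to a node $v$, trace both backwards from $v$ and let $w$ be the first node at which they enter via different edges; $p$ is lower than $p'$ if $p$ enters $w$ via a horizontal edge while $p'$ enters via a diagonal or vertical edge, or $p$ enters via a diagonal edge while $p'$ enters via a vertical edge. A lowest shortest path tree rooted at $(0,0)$ is a shortest path tree such that for every node $v$, the tree path from $(0,0)$ to $v$ is lower than every other shortest path from $(0,0)$ to $v$. -}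

module Defs where

open import Level using (Level)
open import Data.Nat using (ℕ; zero; suc; _≤_; _<_; _⊔_; _≡ᵇ_)
open import Data.Nat.Properties using (_<?_; <-irrelevant)
open import Data.Bool using (Bool; true; false; if_then_else_; _∧_)
open import Data.Fin using (fromℕ<)
open import Data.Vec using (Vec; lookup)
open import Data.List using (List; []; _∷_; length)
open import Data.Maybe using (Maybe; just; nothing)
open import Data.Product using (Σ; _×_; _,_; ∃)
open import Relation.Nullary using (Dec; yes; no; does; ¬_)
open import Relation.Binary.Definitions using (DecidableEquality)
open import Relation.Binary.PropositionalEquality using (_≡_; subst)

Node : Set
Node = ℕ × ℕ

-- The three kinds of edges entering a node (as parent pointers):
--   H = ← (horizontal, from (i , j-1)), D = ↖ (diagonal, from (i-1 , j-1)),
--   V = ↑ (vertical, from (i-1 , j)).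
data Move : Set where
  H D V : Move

data _⋖_ : Move → Move → Set where
  H⋖D : H ⋖ D
  H⋖V : H ⋖ V
  D⋖V : D ⋖ V

module _ {a : Level} {S : Set a} {m n : ℕ} (A : Vec S m) (B : Vec S n) where

  -- Match i j  means  A_{i+1} = B_{j+1}  (0-based i , j; strings are 1-based
  -- in the paper).  The diagonal edge (i , j) → (i+1 , j+1) exists iff Match i j.
  Match : ℕ → ℕ → Set a
  Match i j = Σ (i < m) λ i<m → Σ (j < n) λ j<n →
              lookup A (fromℕ< i<m) ≡ lookup B (fromℕ< j<n)

  -- A path from (0,0) is represented by its list of entering edges,
  -- listed BACKWARDS (last edge first).  IsPath p v : p is a path in G_{A,B}
  -- from (0,0) to v.  (Every node on it is coordinatewise ≤ v, so if v is a
  -- node of the grid, the whole path lies in the grid.)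
  data IsPath : List Move → Node → Set a where
    root : IsPath [] (0 , 0)
    hor  : ∀ {p i j} → IsPath p (i , j) → IsPath (H ∷ p) (i , suc j)
    ver  : ∀ {p i j} → IsPath p (i , j) → IsPath (V ∷ p) (suc i , j)
    dia  : ∀ {p i j} → Match i j → IsPath p (i , j) → IsPath (D ∷ p) (suc i , suc j)

  Shortest : List Move → Node → Set a
  Shortest p v = IsPath p v × (∀ q → IsPath q v → length p ≤ length q)

-- Lower p q : tracing both paths backwards from their common end, at the first
-- node where they enter via different edges, p's edge precedes q's in H < D < V.
data Lower : List Move → List Move → Set where
  here  : ∀ {a b p q} → a ⋖ b → Lower (a ∷ p) (b ∷ q)
  there : ∀ {a p q} → Lower p q → Lower (a ∷ p) (a ∷ q)

data TreePath (par : ℕ → ℕ → Maybe Move) : Node → List Move → Set where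
  troot : TreePath par (0 , 0) []
  thor  : ∀ {p i j} → par i (suc j) ≡ just H → TreePath par (i , j) p →
          TreePath par (i , suc j) (H ∷ p)
  tver  : ∀ {p i j} → par (suc i) j ≡ just V → TreePath par (i , j) p →
          TreePath par (suc i , j) (V ∷ p)
  tdia  : ∀ {p i j} → par (suc i) (suc j) ≡ just D → TreePath par (i , j) p →
          TreePath par (suc i , suc j) (D ∷ p)

-- The parent pointers form a lowest shortest path tree of G_{A,B} rooted at
-- (0,0): every grid node v has a tree path (so the pointers span the grid),
-- which is a shortest path in G_{A,B} (so every tree edge is an edge of G),
-- and which is lower than every other shortest path to v.
IsLowestSPT : ∀ {a} {S : Set a} {m n} (A : Vec S m) (B : Vec S n) →
              (ℕ → ℕ → Maybe Move) → Set a
IsLowestSPT {m = m} {n} A B par =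
  ∀ i j → i ≤ m → j ≤ n →
  Σ (List Move) λ p → TreePath par (i , j) p × Shortest A B p (i , j) ×
    (∀ q → Shortest A B q (i , j) → ¬ (q ≡ p) → Lower p q)

module _ {a : Level} {S : Set a} (_≟_ : DecidableEquality S)
         {m n : ℕ} (A : Vec S m) (B : Vec S n) where

  match? : ∀ i j → Dec (Match A B i j)
  match? i j with i <? m | j <? n
  ... | no ¬p | _ = no λ { (p , _ , _) → ¬p p }
  ... | yes p | no ¬q = no λ { (_ , q , _) → ¬q q }
  ... | yes p | yes q with lookup A (fromℕ< p) ≟ lookup B (fromℕ< q)
  ...   | yes e = yes (p , q , e)
  ...   | no ¬e = no λ { (p' , q' , e') → ¬e
            (subst (λ x → lookup A (fromℕ< x) ≡ lookup B (fromℕ< q)) (<-irrelevant p' p)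
              (subst (λ y → lookup A (fromℕ< p') ≡ lookup B (fromℕ< y)) (<-irrelevant q' q) e')) }

  -- len(i , j) (1-based: the ↖ option at (i+1 , j+1) is present iff A_{i+1} = B_{j+1}).
  len : ℕ → ℕ → ℕ
  len zero j = 0
  len (suc i) zero = 0
  len (suc i) (suc j) =
    if does (match? i j)
    then (len (suc i) j ⊔ len i (suc j)) ⊔ suc (len i j)
    else len (suc i) j ⊔ len i (suc j)

  parent : ℕ → ℕ → Maybe Move
  parent zero zero = nothing
  parent zero (suc j) = just H
  parent (suc i) zero = just V
  parent (suc i) (suc j) =
    if len (suc i) j ≡ᵇ len (suc i) (suc j) then just H
    else if does (match? i j) ∧ (suc (len i j) ≡ᵇ len (suc i) (suc j)) then just D
    else just V

-- Along any path from (0,0) to (i,j), each edge raises i + j by one, or by two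
-- for a diagonal edge, which in turn raises len by at most one; so every path
-- to (i,j) has length at least i + j − len(i,j).  The dynamic program makes
-- every parent edge tight for this bound, so tree paths attain it, and the
-- shortest paths are exactly the tight ones.  A tight path ends with a tight
-- edge, and the tie-breaking order of parent picks the least move among the
-- tight edges entering a node; comparing a tight path with the tree path edge
-- by edge from the end therefore yields the lowest-path property.
module Submission where

open import Defs
open import Data.Nat using (ℕ; zero; suc; _+_; _≤_; _⊔_; s≤s; z≤n)
open import Data.Nat.Properties
  using (≤-trans; ≤-antisym; ≤-reflexive; m≤m⊔n; m≤n⊔m; ⊔-sel;
         +-suc; +-monoʳ-≤; +-monoˡ-≤; +-cancelˡ-≡; +-cancelʳ-≤; suc-injective;
         module ≤-Reasoning)
  renaming (_≟_ to _≟ℕ_)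
open import Data.Bool using (if_then_else_)
open import Data.Vec using (Vec)
open import Data.List using (List; []; _∷_; length)
open import Data.Maybe using (Maybe; just)
open import Data.Maybe.Properties using (just-injective)
open import Data.Product using (Σ; _×_; _,_; proj₁; proj₂)
open import Data.Sum using (_⊎_; inj₁; inj₂)
open import Function using (_∘_)
open import Relation.Nullary using (Dec; yes; no; does; ¬_; contradiction)
open import Relation.Nullary.Decidable using (dec-true; dec-false; _×-dec_)
open import Relation.Binary.Definitions using (DecidableEquality)
open import Relation.Binary.PropositionalEquality
  using (_≡_; _≢_; refl; sym; trans; cong; module ≡-Reasoning)

module _ {a} {P : Set a} where

  -- len (suc i) (suc j) is definitionally lcsStep (match? i j) (len (suc i) j) (len i (suc j)) (len i j).
  lcsStep : Dec P → ℕ → ℕ → ℕ → ℕ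
  lcsStep p? x y z = if does p? then (x ⊔ y) ⊔ suc z else x ⊔ y

  x≤lcsStep : ∀ p? x y z → x ≤ lcsStep p? x y z
  x≤lcsStep (yes _) x y z = ≤-trans (m≤m⊔n x y) (m≤m⊔n _ _)
  x≤lcsStep (no _)  x y z = m≤m⊔n x y

  y≤lcsStep : ∀ p? x y z → y ≤ lcsStep p? x y z
  y≤lcsStep (yes _) x y z = ≤-trans (m≤n⊔m x y) (m≤m⊔n _ _)
  y≤lcsStep (no _)  x y z = m≤n⊔m x y

  suc-z≤lcsStep : ∀ p? x y z → P → suc z ≤ lcsStep p? x y z
  suc-z≤lcsStep (yes _) x y z _ = m≤n⊔m _ (suc z)
  suc-z≤lcsStep (no ¬p) x y z p = contradiction p ¬p

  lcsStep-sel : ∀ p? x y z →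
                lcsStep p? x y z ≡ x ⊎ lcsStep p? x y z ≡ y ⊎ (P × lcsStep p? x y z ≡ suc z)
  lcsStep-sel (yes p) x y z with ⊔-sel (x ⊔ y) (suc z) | ⊔-sel x y
  ... | inj₂ e | _       = inj₂ (inj₂ (p , e))
  ... | inj₁ e | inj₁ e′ = inj₁ (trans e e′)
  ... | inj₁ e | inj₂ e′ = inj₂ (inj₁ (trans e e′))
  lcsStep-sel (no _) x y z with ⊔-sel x y
  ... | inj₁ e = inj₁ e
  ... | inj₂ e = inj₂ (inj₁ e)

squeeze : ∀ k {x y t} → t ≤ k + x → x ≤ y → k + y ≡ t → k + x ≡ t × x ≡ y
squeeze k {x} {y} {t} t≤k+x x≤y k+y≡t = k+x≡t , +-cancelˡ-≡ k x y (trans k+x≡t (sym k+y≡t))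
  where
  k+x≡t : k + x ≡ t
  k+x≡t = ≤-antisym (≤-trans (+-monoʳ-≤ k x≤y) (≤-reflexive k+y≡t)) t≤k+x

module LCS {a} {S : Set a} (_≟_ : DecidableEquality S) {m n : ℕ} (A : Vec S m) (B : Vec S n) where

  L : ℕ → ℕ → ℕ
  L = len _≟_ A B

  par : ℕ → ℕ → Maybe Move
  par = parent _≟_ A B

  len-zeroʳ : ∀ i → L i 0 ≡ 0
  len-zeroʳ zero    = refl
  len-zeroʳ (suc i) = refl

  len-hor-≤ : ∀ i j → L i j ≤ L i (suc j)
  len-hor-≤ zero    j = z≤n
  len-hor-≤ (suc i) j = x≤lcsStep (match? _≟_ A B i j) _ _ _

  len-ver-≤ : ∀ i j → L i j ≤ L (suc i) j
  len-ver-≤ zero    zero    = z≤n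
  len-ver-≤ (suc i) zero    = z≤n
  len-ver-≤ i       (suc j) = y≤lcsStep (match? _≟_ A B i j) _ _ _

  len-dia-< : ∀ {i j} → Match A B i j → suc (L i j) ≤ L (suc i) (suc j)
  len-dia-< {i} {j} = suc-z≤lcsStep (match? _≟_ A B i j) (L (suc i) j) (L i (suc j)) (L i j)

  i+j≤length+len : ∀ {q i j} → IsPath A B q (i , j) → i + j ≤ length q + L i j
  i+j≤length+len root = z≤n
  i+j≤length+len (hor {p} {i} {j} q) =
    ≤-trans (≤-reflexive (+-suc i j)) (s≤s (≤-trans (i+j≤length+len q) (+-monoʳ-≤ (length p) (len-hor-≤ i j))))
  i+j≤length+len (ver {p} {i} {j} q) =
    s≤s (≤-trans (i+j≤length+len q) (+-monoʳ-≤ (length p) (len-ver-≤ i j)))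
  i+j≤length+len (dia {p} {i} {j} mt q) = begin
    suc i + suc j               ≡⟨ cong suc (+-suc i j) ⟩
    suc (suc (i + j))           ≤⟨ s≤s (s≤s (i+j≤length+len q)) ⟩
    suc (suc (length p + L i j)) ≡⟨ cong suc (+-suc (length p) (L i j)) ⟨
    suc (length p + suc (L i j)) ≤⟨ s≤s (+-monoʳ-≤ (length p) (len-dia-< mt)) ⟩
    suc (length p + L (suc i) (suc j)) ∎
    where open ≤-Reasoning

  Tight : List Move → Node → Set
  Tight q (i , j) = length q + L i j ≡ i + j

  Tight-hor⁺ : ∀ {q i j} → Tight q (i , j) → L i j ≡ L i (suc j) → Tight (H ∷ q) (i , suc j)
  Tight-hor⁺ {q} {i} {j} tq h = begin
    suc (length q + L i (suc j)) ≡⟨ cong (suc ∘ (length q +_)) h ⟨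
    suc (length q + L i j)       ≡⟨ cong suc tq ⟩
    suc (i + j)                  ≡⟨ +-suc i j ⟨
    i + suc j                    ∎
    where open ≡-Reasoning

  Tight-ver⁺ : ∀ {q i j} → Tight q (i , j) → L i j ≡ L (suc i) j → Tight (V ∷ q) (suc i , j)
  Tight-ver⁺ {q} tq v rewrite sym v = cong suc tq

  Tight-dia⁺ : ∀ {q i j} → Tight q (i , j) → suc (L i j) ≡ L (suc i) (suc j) →
               Tight (D ∷ q) (suc i , suc j)
  Tight-dia⁺ {q} {i} {j} tq d = cong suc (begin
    length q + L (suc i) (suc j) ≡⟨ cong (length q +_) d ⟨
    length q + suc (L i j)       ≡⟨ +-suc (length q) (L i j) ⟩
    suc (length q + L i j)       ≡⟨ cong suc tq ⟩
    suc (i + j)                  ≡⟨ +-suc i j ⟨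
    i + suc j                    ∎)
    where open ≡-Reasoning

  Tight-hor⁻ : ∀ {q i j} → IsPath A B q (i , j) → Tight (H ∷ q) (i , suc j) →
               Tight q (i , j) × L i j ≡ L i (suc j)
  Tight-hor⁻ {q} {i} {j} ip tq =
    squeeze (length q) (i+j≤length+len ip) (len-hor-≤ i j) (suc-injective (trans tq (+-suc i j)))

  Tight-ver⁻ : ∀ {q i j} → IsPath A B q (i , j) → Tight (V ∷ q) (suc i , j) →
               Tight q (i , j) × L i j ≡ L (suc i) j
  Tight-ver⁻ {q} {i} {j} ip tq =
    squeeze (length q) (i+j≤length+len ip) (len-ver-≤ i j) (suc-injective tq)

  Tight-dia⁻ : ∀ {q i j} → Match A B i j → IsPath A B q (i , j) → Tight (D ∷ q) (suc i , suc j) →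
               Tight q (i , j) × suc (L i j) ≡ L (suc i) (suc j)
  Tight-dia⁻ {q} {i} {j} mt ip tq with squeeze (length q) lowerBound (len-dia-< mt) (suc-injective tq)
    where
    lowerBound : i + suc j ≤ length q + suc (L i j)
    lowerBound = begin
      i + suc j              ≡⟨ +-suc i j ⟩
      suc (i + j)            ≤⟨ s≤s (i+j≤length+len ip) ⟩
      suc (length q + L i j) ≡⟨ +-suc (length q) (L i j) ⟨
      length q + suc (L i j) ∎
      where open ≤-Reasoning
  ... | tq′ , d = suc-injective (trans (sym (+-suc (length q) (L i j))) (trans tq′ (+-suc i j))) , d

  parent-hor : ∀ {i j} → L (suc i) j ≡ L (suc i) (suc j) → par (suc i) (suc j) ≡ just H
  parent-hor {i} {j} h rewrite dec-true (L (suc i) j ≟ℕ L (suc i) (suc j)) h = refl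

  parent-dia : ∀ {i j} → L (suc i) j ≢ L (suc i) (suc j) → Match A B i j →
               suc (L i j) ≡ L (suc i) (suc j) → par (suc i) (suc j) ≡ just D
  parent-dia {i} {j} ¬h mt d
    rewrite dec-false (L (suc i) j ≟ℕ L (suc i) (suc j)) ¬h
          | dec-true (match? _≟_ A B i j ×-dec (suc (L i j) ≟ℕ L (suc i) (suc j))) (mt , d) = refl

  parent-ver : ∀ {i j} → L (suc i) j ≢ L (suc i) (suc j) →
               ¬ (Match A B i j × suc (L i j) ≡ L (suc i) (suc j)) → par (suc i) (suc j) ≡ just V
  parent-ver {i} {j} ¬h ¬d
    rewrite dec-false (L (suc i) j ≟ℕ L (suc i) (suc j)) ¬h
          | dec-false (match? _≟_ A B i j ×-dec (suc (L i j) ≟ℕ L (suc i) (suc j))) ¬d = refl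

  data TightParent (i j : ℕ) : Set a where
    hor : par (suc i) (suc j) ≡ just H → L (suc i) j ≡ L (suc i) (suc j) → TightParent i j
    dia : par (suc i) (suc j) ≡ just D → Match A B i j → suc (L i j) ≡ L (suc i) (suc j) →
          TightParent i j
    ver : par (suc i) (suc j) ≡ just V → L i (suc j) ≡ L (suc i) (suc j) → TightParent i j

  tightParent : ∀ i j → TightParent i j
  tightParent i j with L (suc i) j ≟ℕ L (suc i) (suc j)
  ... | yes h = hor (parent-hor h) h
  ... | no ¬h with match? _≟_ A B i j ×-dec (suc (L i j) ≟ℕ L (suc i) (suc j))
  ...   | yes (mt , d) = dia (parent-dia ¬h mt d) mt d
  ...   | no ¬d = ver (parent-ver ¬h ¬d) v
    where
    v : L i (suc j) ≡ L (suc i) (suc j)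
    v with lcsStep-sel (match? _≟_ A B i j) (L (suc i) j) (L i (suc j)) (L i j)
    ... | inj₁ e               = contradiction (sym e) ¬h
    ... | inj₂ (inj₁ e)        = sym e
    ... | inj₂ (inj₂ (mt , e)) = contradiction (mt , sym e) ¬d

  parent-≢V : ∀ {i j} → Match A B i j → suc (L i j) ≡ L (suc i) (suc j) →
              par (suc i) (suc j) ≢ just V
  parent-≢V {i} {j} mt d with L (suc i) j ≟ℕ L (suc i) (suc j)
  ... | yes h = λ e → contradiction (just-injective (trans (sym (parent-hor h)) e)) λ ()
  ... | no ¬h = λ e → contradiction (just-injective (trans (sym (parent-dia ¬h mt d)) e)) λ ()

  treePath : ∀ i j → Σ (List Move) λ p → TreePath par (i , j) p × IsPath A B p (i , j) × Tight p (i , j)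
  treePath zero zero = [] , troot , root , refl
  treePath zero (suc j) with treePath zero j
  ... | p , t , ip , tp = H ∷ p , thor refl t , hor ip , Tight-hor⁺ {p} {0} {j} tp refl
  treePath (suc i) zero with treePath i zero
  ... | p , t , ip , tp = V ∷ p , tver refl t , ver ip , Tight-ver⁺ {p} {i} {0} tp (len-zeroʳ i)
  treePath (suc i) (suc j) with tightParent i j
  ... | hor e h with treePath (suc i) j
  ...   | p , t , ip , tp = H ∷ p , thor e t , hor ip , Tight-hor⁺ {p} {suc i} {j} tp h
  treePath (suc i) (suc j) | dia e mt d with treePath i j
  ...   | p , t , ip , tp = D ∷ p , tdia e t , dia mt ip , Tight-dia⁺ {p} {i} {j} tp d
  treePath (suc i) (suc j) | ver e v with treePath i (suc j)
  ...   | p , t , ip , tp = V ∷ p , tver e t , ver ip , Tight-ver⁺ {p} {i} {suc j} tp v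

  tree-lowest : ∀ {v p q} → TreePath par v p → IsPath A B q v → Tight q v → q ≢ p → Lower p q
  tree-lowest troot root _ q≢p = contradiction refl q≢p
  tree-lowest (thor e t) (hor ip) tq q≢p =
    there (tree-lowest t ip (proj₁ (Tight-hor⁻ ip tq)) (q≢p ∘ cong (H ∷_)))
  tree-lowest (thor _ _) (ver _)   _ _ = here H⋖V
  tree-lowest (thor _ _) (dia _ _) _ _ = here H⋖D
  tree-lowest (tver e t) (hor ip) tq _ =
    contradiction (just-injective (trans (sym (parent-hor (proj₂ (Tight-hor⁻ ip tq)))) e)) λ ()
  tree-lowest (tver e t) (ver ip) tq q≢p =
    there (tree-lowest t ip (proj₁ (Tight-ver⁻ ip tq)) (q≢p ∘ cong (V ∷_)))
  tree-lowest (tver e t) (dia mt ip) tq _ = contradiction e (parent-≢V mt (proj₂ (Tight-dia⁻ mt ip tq)))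
  tree-lowest (tdia e t) (hor ip) tq _ =
    contradiction (just-injective (trans (sym (parent-hor (proj₂ (Tight-hor⁻ ip tq)))) e)) λ ()
  tree-lowest (tdia _ _) (ver _) _ _ = here D⋖V
  tree-lowest (tdia e t) (dia mt ip) tq q≢p =
    there (tree-lowest t ip (proj₁ (Tight-dia⁻ mt ip tq)) (q≢p ∘ cong (D ∷_)))

  Tight⇒Shortest : ∀ {p i j} → IsPath A B p (i , j) → Tight p (i , j) → Shortest A B p (i , j)
  Tight⇒Shortest {i = i} {j} ip tp =
    ip , λ q iq → +-cancelʳ-≤ (L i j) _ _ (≤-trans (≤-reflexive tp) (i+j≤length+len iq))

  Shortest⇒Tight : ∀ {p q i j} → IsPath A B p (i , j) → Tight p (i , j) →
                   Shortest A B q (i , j) → Tight q (i , j)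
  Shortest⇒Tight {p} {i = i} {j} ip tp (iq , minimal) =
    ≤-antisym (≤-trans (+-monoˡ-≤ (L i j) (minimal p ip)) (≤-reflexive tp)) (i+j≤length+len iq)

lemma3 : ∀ {a} {S : Set a} (_≟_ : DecidableEquality S) {m n : ℕ}
         (A : Vec S m) (B : Vec S n) →
         IsLowestSPT A B (parent _≟_ A B)
lemma3 _≟_ A B i j _ _ =
  let p , t , ip , tp = treePath i j in
  p , t , Tight⇒Shortest ip tp ,
  λ q sq q≢p → tree-lowest t (proj₁ sq) (Shortest⇒Tight ip tp sq) q≢p
  where open LCS _≟_ A B
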